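{- If $G$ is any graph of order $n\geq 3$ and $\overline{G}$ is its complement, then $$\mathrm{Mad}(G)+\mathrm{Mad}(\overline{G})\leq\begin{cases}(5n^2-6n+1)/(4n) & \text{if } n \text{ is odd},\\ (5n^2-6n)/(4n) & \text{if } n \text{ is even}.\end{cases}$$ Moreover, both bounds are tight, so $M(2,n)=5n/4-3/2+\epsilon_n$ for every $n\geq 3$, where $\epsilon_n=0$ if $n$ is even and $\epsilon_n=\frac{1}{4n}$ if $n$ is odd.
   Context: For a finite graph $G$, $\mathrm{Mad}(G)=\max\{2e(H)/|V(H)| : H\subseteq G,\ |V(H)|\geq 1\}$ ($0$ if $G$ has no edges). $M(k,n)$ denotes the maximum of $\sum_{i=1}^k\mathrm{Mad}(G_i)$ over all partitions of $E(K_n)$ into $k$ spanning subgraphs $G_1,\dots,G_k$; in particular $M(2,n)=\max\{\mathrm{Mad}(G)+\mathrm{Mad}(\overline{G}) : |V(G)|=n\}$. -}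

module Defs where

open import Data.Bool using (Bool; true; false; _∧_; not; if_then_else_)
open import Data.Nat as ℕ using (ℕ; zero; suc; _%_)
open import Data.Fin using (Fin; _<_)
open import Data.Fin.Properties using (_<?_)
open import Data.Vec using (Vec; []; _∷_; lookup)
open import Data.List as List using (List; []; _∷_; _++_; map; foldr; allFin; filter; length)
open import Data.Integer using (+_)
import Data.Integer as ℤ
open import Data.Rational using (ℚ; _/_; _⊔_; _+_; _-_; 0ℚ)
open import Relation.Binary.PropositionalEquality using (_≡_)
open import Relation.Nullary.Decidable using (does)

record Graph (n : ℕ) : Set where
  field
    adj   : Fin n → Fin n → Bool
    adj-sym : ∀ i j → adj i j ≡ adj j i
    adj-irrefl : ∀ i → adj i i ≡ false
open Graph public

complement : ∀ {n} → Graph n → Graph n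
complement G = record
  { adj = λ i j → if does (i Data.Fin.≟ j) then false else not (adj G i j)
  ; adj-sym = symProof
  ; adj-irrefl = irr }
  where
    open import Data.Fin using (_≟_)
    open import Relation.Binary.PropositionalEquality using (refl; cong; sym)
    open import Relation.Nullary using (yes; no)
    symProof : ∀ i j → (if does (i Data.Fin.≟ j) then false else not (adj G i j))
                     ≡ (if does (j Data.Fin.≟ i) then false else not (adj G j i))
    symProof i j with i Data.Fin.≟ j | j Data.Fin.≟ i
    ... | yes _ | yes _ = refl
    ... | yes p | no q = Data.Empty.⊥-elim (q (sym p)) where import Data.Empty
    ... | no p | yes q = Data.Empty.⊥-elim (p (sym q)) where import Data.Empty
    ... | no _ | no _ = cong not (adj-sym G i j)
    irr : ∀ i → (if does (i Data.Fin.≟ i) then false else not (adj G i i)) ≡ false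
    irr i with i Data.Fin.≟ i
    ... | yes _ = refl
    ... | no ¬p = Data.Empty.⊥-elim (¬p refl) where import Data.Empty

Subset : ℕ → Set
Subset n = Vec Bool n

allSubsets : (n : ℕ) → List (Subset n)
allSubsets zero = [] ∷ []
allSubsets (suc n) = map (true ∷_) (allSubsets n) ++ map (false ∷_) (allSubsets n)

size : ∀ {n} → Subset n → ℕ
size S = length (List.filterᵇ (lookup S) (allFin _))

edgesIn : ∀ {n} → Graph n → Subset n → ℕ
edgesIn {n} G S =
  length (List.filterᵇ keep
                 (List.cartesianProduct (allFin n) (allFin n)))
  where
    open import Data.Product using (_×_; _,_)
    keep : Fin n × Fin n → Bool
    keep (i , j) = does (i <? j) ∧ lookup S i ∧ lookup S j ∧ adj G i j

-- 2 e(G[S]) / |S|, with value 0 for the empty set (which is never the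
-- maximiser anyway, since all densities are ≥ 0).
density : ∀ {n} → Graph n → Subset n → ℚ
density G S with size S
... | zero = 0ℚ
... | suc k = (+ (2 ℕ.* edgesIn G S)) / suc k

Mad : ∀ {n} → Graph n → ℚ
Mad {n} G = foldr (λ S acc → density G S ⊔ acc) 0ℚ (allSubsets n)

-- The bound of Theorem 4.1 (case form); n = 0 (excluded by n ≥ 3) gets 0.
-- Numerators are computed in ℤ (no truncated subtraction).
bound : ℕ → ℚ
bound zero = 0ℚ
bound (suc m) with suc m % 2
... | zero  = (+ (5 ℕ.* n ℕ.* n) ℤ.- + (6 ℕ.* n)) / (4 ℕ.* suc m)
  where n = suc m
... | suc _ = (+ (5 ℕ.* n ℕ.* n) ℤ.- + (6 ℕ.* n) ℤ.+ + 1) / (4 ℕ.* suc m)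
  where n = suc m

eps : ℕ → ℚ
eps zero = 0ℚ
eps (suc m) with suc m % 2
... | zero  = 0ℚ
... | suc _ = (+ 1) / (4 ℕ.* suc m)

{-# OPTIONS --safe #-}
module Submission where

-- Let A and B attain Mad G and Mad Ḡ, with a = |A| ≤ b = |B| and c = |A ∩ B|.  Each pair inside
-- A ∩ B is an edge of exactly one of G and Ḡ, so it is missing either from G[A] or from Ḡ[B];
-- weighting the two edge counts by b and a gives
--   e(G[A])·b + e(Ḡ[B])·a + a·C(c,2) ≤ C(a,2)·b + C(b,2)·a,
-- that is Mad G + Mad Ḡ ≤ a + b − 2 − c(c−1)/b.  Since c ≥ d = max(0, a + b − n) and b ≤ n,
-- this is at most n − 2 + d(n+1−d)/n, and 4d(n+1−d) ≤ (n+1)² − 1 + ε_n because n + 1 − 2d is odd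
-- when n is even.  A clique on ⌈n/2⌉ vertices (A the clique, B all vertices) attains the bound.

open import Data.Bool using (Bool; true; false; _∧_; not; if_then_else_; T)
open import Data.Bool.Properties using (∧-comm; ∧-zeroʳ)
open import Data.Fin as Fin using (Fin)
open import Data.Fin.Properties using (_<?_; <⇒≢)
open import Data.Fin.Subset using (_∩_; ⊤; ⊥; ∣_∣; _⊆_; inside)
open import Data.Fin.Subset.Properties using (∣p∣≤n; ∣⊤∣≡n; ∣⊥∣≡0; p∩q⊆p; p∩q⊆q; ⊆-refl; ⊆⊤)
open import Data.Integer as ℤ using (ℤ)
open import Data.List as List using ([]; _∷_; _++_; map; length; foldr; tabulate; cartesianProduct)
open import Data.List.Membership.Propositional using (_∈_)
open import Data.List.Membership.Propositional.Properties using (∈-map⁺; ∈-++⁺ˡ; ∈-++⁺ʳ)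
open import Data.List.Properties using (length-++; filter-++; map-tabulate)
open import Data.List.Relation.Unary.Any using (here; there)
open import Data.Nat as ℕ using (ℕ; zero; suc; z≤n; s≤s; _∸_; _%_; ⌊_/2⌋; ⌈_/2⌉)
open import Data.Nat.Combinatorics using (_C_; nC1≡n; nCk+nC[k+1]≡[n+1]C[k+1])
import Data.Nat.Properties as ℕₚ
open import Data.Product using (_×_; _,_; ∃; ∃₂; Σ)
open import Data.Rational as ℚ using (ℚ; 0ℚ; _/_; _⊔_; toℚᵘ; fromℚᵘ)
import Data.Rational.Properties as ℚₚ
open import Data.Rational.Unnormalised as ℚᵘ using (mkℚᵘ; *≡*; *≤*)
import Data.Rational.Unnormalised.Properties as ℚᵘₚ
open import Data.Sum using (_⊎_; inj₁; inj₂)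
open import Data.Vec using ([]; _∷_; lookup)
open import Data.Vec.Properties using ([]=⇒lookup; lookup⇒[]=)
open import Function using (_∘_; id)
open import Relation.Binary.PropositionalEquality
open import Relation.Nullary.Decidable using (does; yes; no)
open import Relation.Nullary.Negation using (contradiction)
open import Algebra.Properties.Semiring.Sum ℕₚ.+-*-semiring
  using (sum; sum-cong-≗; ∑-distrib-+; sum-replicate-zero)

open import Defs

module Halving where
  open import Data.Nat using (_+_; _*_)

  n%2≡0⊎n%2≡1 : ∀ n → n % 2 ≡ 0 ⊎ n % 2 ≡ 1
  n%2≡0⊎n%2≡1 0             = inj₁ refl
  n%2≡0⊎n%2≡1 1             = inj₂ refl
  n%2≡0⊎n%2≡1 (suc (suc n)) = n%2≡0⊎n%2≡1 n

  n≡2⌊n/2⌋+n%2 : ∀ n → n ≡ 2 * ⌊ n /2⌋ + n % 2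
  n≡2⌊n/2⌋+n%2 0             = refl
  n≡2⌊n/2⌋+n%2 1             = refl
  n≡2⌊n/2⌋+n%2 (suc (suc n)) =
    trans (cong (2 +_) (n≡2⌊n/2⌋+n%2 n)) (cong (_+ n % 2) (sym (ℕₚ.*-suc 2 ⌊ n /2⌋)))

  2⌈n/2⌉≡n+n%2 : ∀ n → 2 * ⌈ n /2⌉ ≡ n + n % 2
  2⌈n/2⌉≡n+n%2 0             = refl
  2⌈n/2⌉≡n+n%2 1             = refl
  2⌈n/2⌉≡n+n%2 (suc (suc n)) = trans (ℕₚ.*-suc 2 ⌈ n /2⌉) (cong (2 +_) (2⌈n/2⌉≡n+n%2 n))

open Halving

module Counting where
  open import Data.Nat using (_+_; _*_; _≤_)
  open import Data.Nat.Tactic.RingSolver using (solve-∀)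

  χ : Bool → ℕ
  χ true  = 1
  χ false = 0

  sum-mono-≤ : ∀ {n} {f g : Fin n → ℕ} → (∀ i → f i ≤ g i) → sum f ≤ sum g
  sum-mono-≤ {zero}  f≤g = z≤n
  sum-mono-≤ {suc n} f≤g = ℕₚ.+-mono-≤ (f≤g Fin.zero) (sum-mono-≤ (f≤g ∘ Fin.suc))

  length-filterᵇ-++ : ∀ {A : Set} (p : A → Bool) xs ys →
    length (List.filterᵇ p (xs ++ ys)) ≡ length (List.filterᵇ p xs) + length (List.filterᵇ p ys)
  length-filterᵇ-++ p xs ys = trans (cong length (filter-++ _ xs ys)) (length-++ (List.filterᵇ p xs))

  length-filterᵇ-tabulate : ∀ {A : Set} {n} (p : A → Bool) (f : Fin n → A) →
    length (List.filterᵇ p (tabulate f)) ≡ sum (χ ∘ p ∘ f)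
  length-filterᵇ-tabulate {n = zero}  p f = refl
  length-filterᵇ-tabulate {n = suc n} p f with p (f Fin.zero)
  ... | true  = cong suc (length-filterᵇ-tabulate p (f ∘ Fin.suc))
  ... | false = length-filterᵇ-tabulate p (f ∘ Fin.suc)

  length-filterᵇ-cartesianProduct : ∀ {A B : Set} {m n} (p : A × B → Bool) (f : Fin m → A) (g : Fin n → B) →
    length (List.filterᵇ p (cartesianProduct (tabulate f) (tabulate g))) ≡ sum (λ i → sum (λ j → χ (p (f i , g j))))
  length-filterᵇ-cartesianProduct {m = zero}  p f g = refl
  length-filterᵇ-cartesianProduct {A} {B} {m = suc m} p f g = begin
    length (List.filterᵇ p (map (f Fin.zero ,_) (tabulate g) ++ rest))
      ≡⟨ length-filterᵇ-++ p (map (f Fin.zero ,_) (tabulate g)) rest ⟩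
    length (List.filterᵇ p (map (f Fin.zero ,_) (tabulate g))) + length (List.filterᵇ p rest)
      ≡⟨ cong₂ _+_ (trans (cong (length ∘ List.filterᵇ p) (map-tabulate g (f Fin.zero ,_)))
                          (length-filterᵇ-tabulate p (λ j → f Fin.zero , g j)))
                   (length-filterᵇ-cartesianProduct p (f ∘ Fin.suc) g) ⟩
    sum (λ i → sum (λ j → χ (p (f i , g j)))) ∎
    where
    open ≡-Reasoning
    rest : List.List (A × B)
    rest = cartesianProduct (tabulate (f ∘ Fin.suc)) (tabulate g)

  ∑χ≡∣∣ : ∀ {n} (S : Subset n) → sum (χ ∘ lookup S) ≡ ∣ S ∣
  ∑χ≡∣∣ []          = refl
  ∑χ≡∣∣ (true  ∷ S) = cong suc (∑χ≡∣∣ S)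
  ∑χ≡∣∣ (false ∷ S) = ∑χ≡∣∣ S

  size≡∣∣ : ∀ {n} (S : Subset n) → size S ≡ ∣ S ∣
  size≡∣∣ S = trans (length-filterᵇ-tabulate (lookup S) id) (∑χ≡∣∣ S)

  pairsIn : ∀ {n} → Subset n → ℕ
  pairsIn S = sum (λ i → sum (λ j → χ (does (i <? j) ∧ lookup S i ∧ lookup S j)))

  edgesIn≡∑ : ∀ {n} (G : Graph n) (S : Subset n) →
    edgesIn G S ≡ sum (λ i → sum (λ j → χ (does (i <? j) ∧ lookup S i ∧ lookup S j ∧ adj G i j)))
  edgesIn≡∑ G S = length-filterᵇ-cartesianProduct
    (λ (i , j) → does (i <? j) ∧ lookup S i ∧ lookup S j ∧ adj G i j) id id

  pairsIn≡∣∣C2 : ∀ {n} (S : Subset n) → pairsIn S ≡ ∣ S ∣ C 2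
  pairsIn≡∣∣C2 []                  = refl
  pairsIn≡∣∣C2 {suc n} (false ∷ S) = trans (cong (_+ pairsIn S) (sum-replicate-zero n)) (pairsIn≡∣∣C2 S)
  pairsIn≡∣∣C2 (true ∷ S)          = begin
    sum (χ ∘ lookup S) + pairsIn S  ≡⟨ cong₂ _+_ (trans (∑χ≡∣∣ S) (sym (nC1≡n ∣ S ∣))) (pairsIn≡∣∣C2 S) ⟩
    ∣ S ∣ C 1 + ∣ S ∣ C 2          ≡⟨ nCk+nC[k+1]≡[n+1]C[k+1] ∣ S ∣ 1 ⟩
    suc ∣ S ∣ C 2                  ∎
    where open ≡-Reasoning

  ∣A∣+∣B∣≤n+∣A∩B∣ : ∀ {n} (A B : Subset n) → ∣ A ∣ + ∣ B ∣ ≤ n + ∣ A ∩ B ∣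
  ∣A∣+∣B∣≤n+∣A∩B∣ []          []                  = z≤n
  ∣A∣+∣B∣≤n+∣A∩B∣ (false ∷ A) (false ∷ B)         = ℕₚ.m≤n⇒m≤1+n (∣A∣+∣B∣≤n+∣A∩B∣ A B)
  ∣A∣+∣B∣≤n+∣A∩B∣ {suc n} (false ∷ A) (true ∷ B) =
    subst (_≤ suc n + ∣ A ∩ B ∣) (sym (ℕₚ.+-suc ∣ A ∣ ∣ B ∣)) (s≤s (∣A∣+∣B∣≤n+∣A∩B∣ A B))
  ∣A∣+∣B∣≤n+∣A∩B∣ (true ∷ A)  (false ∷ B)         = s≤s (∣A∣+∣B∣≤n+∣A∩B∣ A B)
  ∣A∣+∣B∣≤n+∣A∩B∣ {suc n} (true ∷ A) (true ∷ B)  =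
    s≤s (subst₂ _≤_ (sym (ℕₚ.+-suc ∣ A ∣ ∣ B ∣)) (sym (ℕₚ.+-suc n ∣ A ∩ B ∣))
                    (s≤s (∣A∣+∣B∣≤n+∣A∩B∣ A B)))

  subset-of-size : ∀ {n k} → k ≤ n → Σ (Subset n) λ S → ∣ S ∣ ≡ k
  subset-of-size {n} {zero}        _         = ⊥ , ∣⊥∣≡0 n
  subset-of-size {suc n} {suc k} (s≤s k≤n) with subset-of-size k≤n
  ... | S , ∣S∣≡k = inside ∷ S , cong suc ∣S∣≡k

  <?⇒≢ : ∀ {n} (i j : Fin n) → T (does (i <? j)) → i ≢ j
  <?⇒≢ i j = <⇒≢ ∘ ℕₚ.<ᵇ⇒< (Fin.toℕ i) (Fin.toℕ j)

  ⊆⇒lookup : ∀ {n} {S T : Subset n} → S ⊆ T → ∀ i → lookup S i ≡ true → lookup T i ≡ true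
  ⊆⇒lookup {S = S} S⊆T i Sᵢ = []=⇒lookup (S⊆T (lookup⇒[]= i S Sᵢ))

  edgesIn-mono : ∀ {n} (G : Graph n) {S T : Subset n} → S ⊆ T → edgesIn G S ≤ edgesIn G T
  edgesIn-mono G {S} {T} S⊆T = subst₂ _≤_ (sym (edgesIn≡∑ G S)) (sym (edgesIn≡∑ G T))
    (sum-mono-≤ λ i → sum-mono-≤ λ j →
      χ-mono (does (i <? j)) (lookup S i) (lookup S j) (adj G i j) (⊆⇒lookup S⊆T i) (⊆⇒lookup S⊆T j))
    where
    χ-mono : ∀ l c d x {a b} → (c ≡ true → a ≡ true) → (d ≡ true → b ≡ true) →
             χ (l ∧ c ∧ d ∧ x) ≤ χ (l ∧ a ∧ b ∧ x)
    χ-mono false _     _     _     _   _   = z≤n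
    χ-mono true  false _     _     _   _   = z≤n
    χ-mono true  true  false _     _   _   = z≤n
    χ-mono true  true  true  false _   _   = z≤n
    χ-mono true  true  true  true  c⇒a d⇒b rewrite c⇒a refl | d⇒b refl = ℕₚ.≤-refl

  adj-complement : ∀ {n} (G : Graph n) {i j : Fin n} → i ≢ j → adj (complement G) i j ≡ not (adj G i j)
  adj-complement G {i} {j} i≢j with i Fin.≟ j
  ... | yes i≡j = contradiction i≡j i≢j
  ... | no _    = refl

  edgesIn+edgesIn-complement : ∀ {n} (G : Graph n) (S : Subset n) →
    edgesIn G S + edgesIn (complement G) S ≡ pairsIn S
  edgesIn+edgesIn-complement G S = begin
    edgesIn G S + edgesIn (complement G) S
      ≡⟨ cong₂ _+_ (edgesIn≡∑ G S) (edgesIn≡∑ (complement G) S) ⟩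
    sum (λ i → sum (χ ∘ edge i)) + sum (λ i → sum (χ ∘ coedge i))
      ≡⟨ ∑-distrib-+ (λ i → sum (χ ∘ edge i)) (λ i → sum (χ ∘ coedge i)) ⟨
    sum (λ i → sum (χ ∘ edge i) + sum (χ ∘ coedge i))
      ≡⟨ sum-cong-≗ (λ i → trans (sum-cong-≗ (split i)) (∑-distrib-+ (χ ∘ edge i) (χ ∘ coedge i))) ⟨
    pairsIn S ∎
    where
    open ≡-Reasoning
    edge coedge : Fin _ → Fin _ → Bool
    edge   i j = does (i <? j) ∧ lookup S i ∧ lookup S j ∧ adj G i j
    coedge i j = does (i <? j) ∧ lookup S i ∧ lookup S j ∧ adj (complement G) i j
    χ-split : ∀ l a b x {y} → (T l → y ≡ not x) → χ (l ∧ a ∧ b) ≡ χ (l ∧ a ∧ b ∧ x) + χ (l ∧ a ∧ b ∧ y)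
    χ-split false a     b     x     _    = refl
    χ-split true  false b     x     _    = refl
    χ-split true  true  false x     _    = refl
    χ-split true  true  true  false y≡x̄ rewrite y≡x̄ _ = refl
    χ-split true  true  true  true  y≡x̄ rewrite y≡x̄ _ = refl
    split : ∀ i j → χ (does (i <? j) ∧ lookup S i ∧ lookup S j) ≡ χ (edge i j) + χ (coedge i j)
    split i j = χ-split (does (i <? j)) (lookup S i) (lookup S j) (adj G i j)
                  (adj-complement G ∘ <?⇒≢ i j)

  edgesIn-complement-involutive : ∀ {n} (G : Graph n) (S : Subset n) →
    edgesIn (complement (complement G)) S ≡ edgesIn G S
  edgesIn-complement-involutive G S = ℕₚ.+-cancelˡ-≡ (edgesIn (complement G) S) _ _ (begin
    edgesIn (complement G) S + edgesIn (complement (complement G)) S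
      ≡⟨ edgesIn+edgesIn-complement (complement G) S ⟩
    pairsIn S
      ≡⟨ edgesIn+edgesIn-complement G S ⟨
    edgesIn G S + edgesIn (complement G) S
      ≡⟨ ℕₚ.+-comm (edgesIn G S) _ ⟩
    edgesIn (complement G) S + edgesIn G S ∎)
    where open ≡-Reasoning

  clique : ∀ {n} → Subset n → Graph n
  clique A = record
    { adj        = λ i j → if does (i Fin.≟ j) then false else (lookup A i ∧ lookup A j)
    ; adj-sym    = symmetric
    ; adj-irrefl = irreflexive
    }
    where
    symmetric : ∀ i j → (if does (i Fin.≟ j) then false else (lookup A i ∧ lookup A j))
                      ≡ (if does (j Fin.≟ i) then false else (lookup A j ∧ lookup A i))
    symmetric i j with i Fin.≟ j | j Fin.≟ i
    ... | yes _   | yes _   = refl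
    ... | yes i≡j | no j≢i  = contradiction (sym i≡j) j≢i
    ... | no i≢j  | yes j≡i = contradiction (sym j≡i) i≢j
    ... | no _    | no _    = ∧-comm (lookup A i) (lookup A j)
    irreflexive : ∀ i → (if does (i Fin.≟ i) then false else (lookup A i ∧ lookup A i)) ≡ false
    irreflexive i with i Fin.≟ i
    ... | yes _  = refl
    ... | no i≢i = contradiction refl i≢i

  adj-clique : ∀ {n} (A : Subset n) {i j : Fin n} → i ≢ j → adj (clique A) i j ≡ lookup A i ∧ lookup A j
  adj-clique A {i} {j} i≢j with i Fin.≟ j
  ... | yes i≡j = contradiction i≡j i≢j
  ... | no _    = refl

  edgesIn-clique : ∀ {n} {A S : Subset n} → A ⊆ S → edgesIn (clique A) S ≡ pairsIn A
  edgesIn-clique {A = A} {S} A⊆S = trans (edgesIn≡∑ (clique A) S)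
    (sum-cong-≗ λ i → sum-cong-≗ λ j →
      χ-clique (does (i <? j)) (lookup A i) (lookup A j) (lookup S i) (lookup S j)
        (⊆⇒lookup A⊆S i) (⊆⇒lookup A⊆S j) (adj-clique A ∘ <?⇒≢ i j))
    where
    ∧∧false : ∀ s t → s ∧ t ∧ false ≡ false
    ∧∧false s t = trans (cong (s ∧_) (∧-zeroʳ t)) (∧-zeroʳ s)
    χ-clique : ∀ l a b s t {y} → (a ≡ true → s ≡ true) → (b ≡ true → t ≡ true) → (T l → y ≡ a ∧ b) →
               χ (l ∧ s ∧ t ∧ y) ≡ χ (l ∧ a ∧ b)
    χ-clique false _     _     _ _ _   _   _    = refl
    χ-clique true  a     b     s t a⇒s b⇒t y≡ab with y≡ab _
    χ-clique true  true  true  s t a⇒s b⇒t _ | refl rewrite a⇒s refl | b⇒t refl = refl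
    χ-clique true  true  false s t _   _   _ | refl = cong χ (∧∧false s t)
    χ-clique true  false b     s t _   _   _ | refl = cong χ (∧∧false s t)

  weighted-sum-≤ : ∀ {a b e f x y p q} → a ≤ b → e + x ≤ p → f + y ≤ q →
    e * b + f * a + a * (y + x) ≤ p * b + q * a
  weighted-sum-≤ {a} {b} {e} {f} {x} {y} {p} {q} a≤b e+x≤p f+y≤q = begin
    e * b + f * a + a * (y + x)   ≡⟨ regroup₁ e b f a y x ⟩
    e * b + a * x + (f + y) * a   ≤⟨ ℕₚ.+-monoˡ-≤ ((f + y) * a) (ℕₚ.+-monoʳ-≤ (e * b) (ℕₚ.*-monoˡ-≤ x a≤b)) ⟩
    e * b + b * x + (f + y) * a   ≡⟨ regroup₂ e b f a y x ⟩
    (e + x) * b + (f + y) * a     ≤⟨ ℕₚ.+-mono-≤ (ℕₚ.*-monoˡ-≤ b e+x≤p) (ℕₚ.*-monoˡ-≤ a f+y≤q) ⟩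
    p * b + q * a                 ∎
    where
    open ℕₚ.≤-Reasoning
    regroup₁ : ∀ e b f a y x → e * b + f * a + a * (y + x) ≡ e * b + a * x + (f + y) * a
    regroup₁ = solve-∀
    regroup₂ : ∀ e b f a y x → e * b + b * x + (f + y) * a ≡ (e + x) * b + (f + y) * a
    regroup₂ = solve-∀

  double-count : ∀ {n} (G : Graph n) (A B : Subset n) → ∣ A ∣ ≤ ∣ B ∣ →
    edgesIn G A * ∣ B ∣ + edgesIn (complement G) B * ∣ A ∣ + ∣ A ∣ * (∣ A ∩ B ∣ C 2)
    ≤ (∣ A ∣ C 2) * ∣ B ∣ + (∣ B ∣ C 2) * ∣ A ∣
  double-count {n} G A B ∣A∣≤∣B∣ =
    subst (λ k → edgesIn G A * ∣ B ∣ + edgesIn Ḡ B * ∣ A ∣ + ∣ A ∣ * k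
                 ≤ (∣ A ∣ C 2) * ∣ B ∣ + (∣ B ∣ C 2) * ∣ A ∣)
      (trans (edgesIn+edgesIn-complement G (A ∩ B)) (pairsIn≡∣∣C2 (A ∩ B)))
      (weighted-sum-≤ {e = edgesIn G A} {f = edgesIn Ḡ B} {x = edgesIn Ḡ (A ∩ B)} {y = edgesIn G (A ∩ B)}
        ∣A∣≤∣B∣ eA+x≤ fB+y≤)
    where
    Ḡ : Graph n
    Ḡ = complement G
    eA+x≤ : edgesIn G A + edgesIn Ḡ (A ∩ B) ≤ ∣ A ∣ C 2
    eA+x≤ = ℕₚ.≤-trans (ℕₚ.+-monoʳ-≤ (edgesIn G A) (edgesIn-mono Ḡ (p∩q⊆p A B)))
              (ℕₚ.≤-reflexive (trans (edgesIn+edgesIn-complement G A) (pairsIn≡∣∣C2 A)))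
    fB+y≤ : edgesIn Ḡ B + edgesIn G (A ∩ B) ≤ ∣ B ∣ C 2
    fB+y≤ = ℕₚ.≤-trans (ℕₚ.+-monoʳ-≤ (edgesIn Ḡ B) (edgesIn-mono G (p∩q⊆q A B)))
              (ℕₚ.≤-reflexive (trans (ℕₚ.+-comm (edgesIn Ḡ B) _)
                (trans (edgesIn+edgesIn-complement G B) (pairsIn≡∣∣C2 B))))

open Counting

module IntegerBounds where
  open import Data.Integer using (ℤ; +_; -[1+_]; 0ℤ; 1ℤ; _+_; _-_; _*_; _≤_; +≤+)
  import Data.Integer.Properties as ℤₚ
  open import Data.Integer.Tactic.RingSolver using (solve-∀)

  ≤-by-certificate : ∀ {i j} k → j - i ≡ k → 0ℤ ≤ k → i ≤ j
  ≤-by-certificate k j-i≡k 0≤k = ℤₚ.0≤i-j⇒j≤i (subst (0ℤ ≤_) (sym j-i≡k) 0≤k)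

  0≤+ : ∀ n → 0ℤ ≤ + n
  0≤+ n = +≤+ z≤n

  0≤i+j : ∀ {i j} → 0ℤ ≤ i → 0ℤ ≤ j → 0ℤ ≤ i + j
  0≤i+j = ℤₚ.+-mono-≤

  0≤i*j : ∀ {i j} → 0ℤ ≤ i → 0ℤ ≤ j → 0ℤ ≤ i * j
  0≤i*j {+ m} {+ n} _ _ = subst (0ℤ ≤_) (ℤₚ.pos-* m n) (0≤+ (m ℕ.* n))

  0≤j-i : ∀ {i j} → i ≤ j → 0ℤ ≤ j - i
  0≤j-i = ℤₚ.i≤j⇒0≤j-i

  0≤x*[x-1] : ∀ x → 0ℤ ≤ x * (x - 1ℤ)
  0≤x*[x-1] (+ zero)    = 0≤+ 0
  0≤x*[x-1] (+ suc k)   = subst (0ℤ ≤_) (ℤₚ.pos-* (suc k) k) (0≤+ (suc k ℕ.* k))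
  0≤x*[x-1] -[1+ k ]    = 0≤+ _

  x*[x-1]-mono : ∀ {d c} → 0ℤ ≤ d → d ≤ c → d * (d - 1ℤ) ≤ c * (c - 1ℤ)
  x*[x-1]-mono {d} {c} 0≤d d≤c =
    ≤-by-certificate ((c - d) * ((c - d) - 1ℤ) + + 2 * d * (c - d)) (identity c d)
      (0≤i+j (0≤x*[x-1] (c - d)) (0≤i*j (0≤i*j (0≤+ 2) 0≤d) (0≤j-i d≤c)))
    where
    identity : ∀ c d → c * (c - 1ℤ) - d * (d - 1ℤ) ≡ (c - d) * ((c - d) - 1ℤ) + + 2 * d * (c - d)
    identity = solve-∀

  -- Divided by 4nb: a + b − 2 − c(c−1)/b ≤ (5n² − 6n + ε)/(4n).
  core-bound : ∀ {n a b c d ε} → 0ℤ ≤ b → b ≤ n → 0ℤ ≤ d → d ≤ c → a + b ≤ n + d →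
    + 4 * d * (n + 1ℤ - d) ≤ n * n + + 2 * n + ε →
    + 4 * n * (b * (a + b - + 2) - c * (c - 1ℤ)) ≤ (+ 5 * n * n - + 6 * n + ε) * b
  core-bound {n} {a} {b} {c} {d} {ε} 0≤b b≤n 0≤d d≤c a+b≤n+d parity =
    ≤-by-certificate
      (b * (n * n + + 2 * n + ε - + 4 * d * (n + 1ℤ - d))
        + + 4 * (n - b) * (d * (d - 1ℤ))
        + + 4 * n * (c * (c - 1ℤ) - d * (d - 1ℤ))
        + + 4 * n * b * (n + d - (a + b)))
      (identity n a b c d ε)
      (0≤i+j (0≤i+j (0≤i+j
        (0≤i*j 0≤b (0≤j-i parity))
        (0≤i*j (0≤i*j (0≤+ 4) (0≤j-i b≤n)) (0≤x*[x-1] d)))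
        (0≤i*j (0≤i*j (0≤+ 4) 0≤n) (0≤j-i (x*[x-1]-mono 0≤d d≤c))))
        (0≤i*j (0≤i*j (0≤i*j (0≤+ 4) 0≤n) 0≤b) (0≤j-i a+b≤n+d)))
    where
    0≤n : 0ℤ ≤ n
    0≤n = ℤₚ.≤-trans 0≤b b≤n
    identity : ∀ n a b c d ε →
      (+ 5 * n * n - + 6 * n + ε) * b - + 4 * n * (b * (a + b - + 2) - c * (c - 1ℤ))
      ≡ b * (n * n + + 2 * n + ε - + 4 * d * (n + 1ℤ - d))
        + + 4 * (n - b) * (d * (d - 1ℤ))
        + + 4 * n * (c * (c - 1ℤ) - d * (d - 1ℤ))
        + + 4 * n * b * (n + d - (a + b))
    identity = solve-∀

  cross-multiplied-bound : ∀ {n a b c d ε e f} → 0ℤ ≤ a → 0ℤ ≤ b → b ≤ n → 0ℤ ≤ d → d ≤ c → a + b ≤ n + d →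
    + 4 * d * (n + 1ℤ - d) ≤ n * n + + 2 * n + ε →
    e * b + f * a + a * (c * (c - 1ℤ)) ≤ b * (a * (a - 1ℤ)) + a * (b * (b - 1ℤ)) →
    (e * b + f * a) * (+ 4 * n) ≤ (+ 5 * n * n - + 6 * n + ε) * (a * b)
  cross-multiplied-bound {n} {a} {b} {c} {d} {ε} {e} {f} 0≤a 0≤b b≤n 0≤d d≤c a+b≤n+d parity weighted =
    ≤-by-certificate
      (+ 4 * n * (b * (a * (a - 1ℤ)) + a * (b * (b - 1ℤ)) - (e * b + f * a + a * (c * (c - 1ℤ))))
        + a * ((+ 5 * n * n - + 6 * n + ε) * b - + 4 * n * (b * (a + b - + 2) - c * (c - 1ℤ))))
      (identity n a b c ε e f)
      (0≤i+j (0≤i*j (0≤i*j (0≤+ 4) (ℤₚ.≤-trans 0≤b b≤n)) (0≤j-i weighted))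
             (0≤i*j 0≤a (0≤j-i (core-bound {a = a} 0≤b b≤n 0≤d d≤c a+b≤n+d parity))))
    where
    identity : ∀ n a b c ε e f →
      (+ 5 * n * n - + 6 * n + ε) * (a * b) - (e * b + f * a) * (+ 4 * n)
      ≡ + 4 * n * (b * (a * (a - 1ℤ)) + a * (b * (b - 1ℤ)) - (e * b + f * a + a * (c * (c - 1ℤ))))
        + a * ((+ 5 * n * n - + 6 * n + ε) * b - + 4 * n * (b * (a + b - + 2) - c * (c - 1ℤ)))
    identity = solve-∀

  4d[n+1-d]≤n²+2n-even : ∀ h d →
    + 4 * d * (+ 2 * h + 0ℤ + 1ℤ - d) ≤ (+ 2 * h + 0ℤ) * (+ 2 * h + 0ℤ) + + 2 * (+ 2 * h + 0ℤ) + 0ℤ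
  4d[n+1-d]≤n²+2n-even h d =
    ≤-by-certificate (+ 4 * (x * (x - 1ℤ))) (identity h d) (0≤i*j (0≤+ 4) (0≤x*[x-1] x))
    where
    x : ℤ
    x = h - d + 1ℤ
    identity : ∀ h d → (+ 2 * h + 0ℤ) * (+ 2 * h + 0ℤ) + + 2 * (+ 2 * h + 0ℤ) + 0ℤ - + 4 * d * (+ 2 * h + 0ℤ + 1ℤ - d)
                       ≡ + 4 * ((h - d + 1ℤ) * (h - d + 1ℤ - 1ℤ))
    identity = solve-∀

  4d[n+1-d]≤n²+2n+1-odd : ∀ h d →
    + 4 * d * (+ 2 * h + 1ℤ + 1ℤ - d) ≤ (+ 2 * h + 1ℤ) * (+ 2 * h + 1ℤ) + + 2 * (+ 2 * h + 1ℤ) + 1ℤ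
  4d[n+1-d]≤n²+2n+1-odd h d =
    ≤-by-certificate (+ 2 * (y * (y - 1ℤ)) + + 2 * ((y + 1ℤ) * (y + 1ℤ - 1ℤ))) (identity h d)
      (0≤i+j (0≤i*j (0≤+ 2) (0≤x*[x-1] y)) (0≤i*j (0≤+ 2) (0≤x*[x-1] (y + 1ℤ))))
    where
    y : ℤ
    y = h + 1ℤ - d
    identity : ∀ h d → (+ 2 * h + 1ℤ) * (+ 2 * h + 1ℤ) + + 2 * (+ 2 * h + 1ℤ) + 1ℤ - + 4 * d * (+ 2 * h + 1ℤ + 1ℤ - d)
                       ≡ + 2 * ((h + 1ℤ - d) * (h + 1ℤ - d - 1ℤ)) + + 2 * ((h + 1ℤ - d + 1ℤ) * (h + 1ℤ - d + 1ℤ - 1ℤ))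
    identity = solve-∀

  +n≡2⌊n/2⌋+n%2 : ∀ n → + n ≡ + 2 * + ⌊ n /2⌋ + + (n % 2)
  +n≡2⌊n/2⌋+n%2 n = trans (cong +_ (n≡2⌊n/2⌋+n%2 n))
    (trans (ℤₚ.pos-+ (2 ℕ.* ⌊ n /2⌋) (n % 2)) (cong (_+ + (n % 2)) (ℤₚ.pos-* 2 ⌊ n /2⌋)))

  4d[n+1-d]≤n²+2n+n%2 : ∀ n d → + 4 * d * (+ n + 1ℤ - d) ≤ + n * + n + + 2 * + n + + (n % 2)
  4d[n+1-d]≤n²+2n+n%2 n d with n % 2 | n%2≡0⊎n%2≡1 n | +n≡2⌊n/2⌋+n%2 n
  ... | _ | inj₁ refl | n≡2h   =
    subst (λ m → + 4 * d * (m + 1ℤ - d) ≤ m * m + + 2 * m + 0ℤ) (sym n≡2h) (4d[n+1-d]≤n²+2n-even (+ ⌊ n /2⌋) d)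
  ... | _ | inj₂ refl | n≡2h+1 =
    subst (λ m → + 4 * d * (m + 1ℤ - d) ≤ m * m + + 2 * m + 1ℤ) (sym n≡2h+1) (4d[n+1-d]≤n²+2n+1-odd (+ ⌊ n /2⌋) d)

  2*nC2+n≡n*n : ∀ n → 2 ℕ.* (n C 2) ℕ.+ n ≡ n ℕ.* n
  2*nC2+n≡n*n zero    = refl
  2*nC2+n≡n*n (suc n) = begin
    2 ℕ.* (suc n C 2) ℕ.+ suc n              ≡⟨ cong (λ k → 2 ℕ.* k ℕ.+ suc n) Pascal ⟩
    2 ℕ.* (n ℕ.+ n C 2) ℕ.+ suc n            ≡⟨ regroup₁ n (n C 2) ⟩
    (2 ℕ.* (n C 2) ℕ.+ n) ℕ.+ suc (2 ℕ.* n)  ≡⟨ cong (ℕ._+ suc (2 ℕ.* n)) (2*nC2+n≡n*n n) ⟩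
    n ℕ.* n ℕ.+ suc (2 ℕ.* n)                ≡⟨ regroup₂ n ⟩
    suc n ℕ.* suc n                          ∎
    where
    open ≡-Reasoning
    open import Data.Nat.Tactic.RingSolver renaming (solve-∀ to solve-∀ℕ)
    Pascal : suc n C 2 ≡ n ℕ.+ n C 2
    Pascal = trans (sym (nCk+nC[k+1]≡[n+1]C[k+1] n 1)) (cong (ℕ._+ n C 2) (nC1≡n n))
    regroup₁ : ∀ n c → 2 ℕ.* (n ℕ.+ c) ℕ.+ suc n ≡ (2 ℕ.* c ℕ.+ n) ℕ.+ suc (2 ℕ.* n)
    regroup₁ = solve-∀ℕ
    regroup₂ : ∀ n → n ℕ.* n ℕ.+ suc (2 ℕ.* n) ≡ suc n ℕ.* suc n
    regroup₂ = solve-∀ℕ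

  +2*nC2≡n*[n-1] : ∀ n → + 2 * + (n C 2) ≡ + n * (+ n - 1ℤ)
  +2*nC2≡n*[n-1] n = begin
    + 2 * + (n C 2)                ≡⟨ identity₁ (+ 2 * + (n C 2)) (+ n) ⟩
    (+ 2 * + (n C 2) + + n) - + n  ≡⟨ cong (_- + n) cast ⟩
    + n * + n - + n                ≡⟨ identity₂ (+ n) ⟩
    + n * (+ n - 1ℤ)               ∎
    where
    open ≡-Reasoning
    cast : + 2 * + (n C 2) + + n ≡ + n * + n
    cast = trans (cong (_+ + n) (sym (ℤₚ.pos-* 2 (n C 2))))
             (trans (sym (ℤₚ.pos-+ (2 ℕ.* (n C 2)) n)) (trans (cong +_ (2*nC2+n≡n*n n)) (ℤₚ.pos-* n n)))
    identity₁ : ∀ x n → x ≡ (x + n) - n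
    identity₁ = solve-∀
    identity₂ : ∀ n → n * n - n ≡ n * (n - 1ℤ)
    identity₂ = solve-∀

  doubled-weighted-sum : ∀ {a b c e f} →
    e ℕ.* b ℕ.+ f ℕ.* a ℕ.+ a ℕ.* (c C 2) ℕ.≤ (a C 2) ℕ.* b ℕ.+ (b C 2) ℕ.* a →
    + (2 ℕ.* e) * + b + + (2 ℕ.* f) * + a + + a * (+ c * (+ c - 1ℤ)) ≤ + b * (+ a * (+ a - 1ℤ)) + + a * (+ b * (+ b - 1ℤ))
  doubled-weighted-sum {a} {b} {c} {e} {f} weighted = begin
    + (2 ℕ.* e) * + b + + (2 ℕ.* f) * + a + + a * (+ c * (+ c - 1ℤ))
      ≡⟨ cong₂ _+_ (cong₂ _+_ (cong (_* + b) (ℤₚ.pos-* 2 e)) (cong (_* + a) (ℤₚ.pos-* 2 f)))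
                   (cong (_*_ (+ a)) (sym (+2*nC2≡n*[n-1] c))) ⟩
    + 2 * + e * + b + + 2 * + f * + a + + a * (+ 2 * + (c C 2))
      ≡⟨ regroup₁ (+ e) (+ b) (+ f) (+ a) (+ (c C 2)) ⟩
    + 2 * (+ e * + b + + f * + a + + a * + (c C 2))
      ≡⟨ cong (_*_ (+ 2)) (trans (ℤₚ.pos-+ (e ℕ.* b ℕ.+ f ℕ.* a) _)
           (cong₂ _+_ (trans (ℤₚ.pos-+ (e ℕ.* b) _) (cong₂ _+_ (ℤₚ.pos-* e b) (ℤₚ.pos-* f a))) (ℤₚ.pos-* a (c C 2)))) ⟨
    + 2 * + (e ℕ.* b ℕ.+ f ℕ.* a ℕ.+ a ℕ.* (c C 2))
      ≤⟨ ℤₚ.*-monoˡ-≤-nonNeg (+ 2) (+≤+ weighted) ⟩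
    + 2 * + ((a C 2) ℕ.* b ℕ.+ (b C 2) ℕ.* a)
      ≡⟨ cong (_*_ (+ 2)) (trans (ℤₚ.pos-+ ((a C 2) ℕ.* b) _) (cong₂ _+_ (ℤₚ.pos-* (a C 2) b) (ℤₚ.pos-* (b C 2) a))) ⟩
    + 2 * (+ (a C 2) * + b + + (b C 2) * + a)
      ≡⟨ regroup₂ (+ (a C 2)) (+ b) (+ (b C 2)) (+ a) ⟩
    + b * (+ 2 * + (a C 2)) + + a * (+ 2 * + (b C 2))
      ≡⟨ cong₂ _+_ (cong (_*_ (+ b)) (+2*nC2≡n*[n-1] a)) (cong (_*_ (+ a)) (+2*nC2≡n*[n-1] b)) ⟩
    + b * (+ a * (+ a - 1ℤ)) + + a * (+ b * (+ b - 1ℤ)) ∎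
    where
    open ℤₚ.≤-Reasoning
    regroup₁ : ∀ e b f a k → + 2 * e * b + + 2 * f * a + a * (+ 2 * k) ≡ + 2 * (e * b + f * a + a * k)
    regroup₁ = solve-∀
    regroup₂ : ∀ p b q a → + 2 * (p * b + q * a) ≡ b * (+ 2 * p) + a * (+ 2 * q)
    regroup₂ = solve-∀

  numer : ℕ → ℤ
  numer n = + 5 * + n * + n - + 6 * + n + + (n % 2)

  numerator-bound : ∀ {n a b c e f} → b ℕ.≤ n → a ℕ.+ b ℕ.≤ n ℕ.+ c →
    e ℕ.* b ℕ.+ f ℕ.* a ℕ.+ a ℕ.* (c C 2) ℕ.≤ (a C 2) ℕ.* b ℕ.+ (b C 2) ℕ.* a →
    (+ (2 ℕ.* e) * + b + + (2 ℕ.* f) * + a) * + (4 ℕ.* n) ≤ numer n * + (a ℕ.* b)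
  numerator-bound {n} {a} {b} {c} {e} {f} b≤n a+b≤n+c weighted =
    subst₂ _≤_ (cong (_*_ E) (sym (ℤₚ.pos-* 4 n))) (cong (_*_ (numer n)) (sym (ℤₚ.pos-* a b)))
      (cross-multiplied-bound {e = + (2 ℕ.* e)} {f = + (2 ℕ.* f)}
        (0≤+ a) (0≤+ b) (+≤+ b≤n) (0≤+ d) (+≤+ d≤c) a+b≤n+d
        (4d[n+1-d]≤n²+2n+n%2 n (+ d)) (doubled-weighted-sum {a} {b} {c} {e} {f} weighted))
    where
    E : ℤ
    E = + (2 ℕ.* e) * + b + + (2 ℕ.* f) * + a
    d : ℕ
    d = (a ℕ.+ b) ∸ n
    d≤c : d ℕ.≤ c
    d≤c = ℕₚ.m≤n+o⇒m∸n≤o (a ℕ.+ b) n a+b≤n+c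
    a+b≤n+d : + a + + b ≤ + n + + d
    a+b≤n+d = subst₂ _≤_ (ℤₚ.pos-+ a b) (ℤₚ.pos-+ n d) (+≤+ (ℕₚ.m≤n+m∸n (a ℕ.+ b) n))

  extremal-cross-multiplied : ∀ {n a ε} → n + ε ≡ + 2 * a → ε * ε ≡ ε →
    (a * (a - 1ℤ) * n + (n * (n - 1ℤ) - a * (a - 1ℤ)) * a) * (+ 4 * n) ≡ (+ 5 * n * n - + 6 * n + ε) * (a * n)
  extremal-cross-multiplied {n} {a} {ε} n+ε≡2a ε*ε≡ε = sym (ℤₚ.i-j≡0⇒i≡j _ _ (begin
    (+ 5 * n * n - + 6 * n + ε) * (a * n) - (a * (a - 1ℤ) * n + (n * (n - 1ℤ) - a * (a - 1ℤ)) * a) * (+ 4 * n)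
      ≡⟨ identity n a ε ⟩
    a * n * ((+ 2 * a - (n + ε)) * (+ 2 * a - n + ε - + 2) + (ε * ε - ε))
      ≡⟨ cong₂ (λ s t → a * n * ((+ 2 * a - s) * (+ 2 * a - n + ε - + 2) + (t - ε))) n+ε≡2a ε*ε≡ε ⟩
    a * n * ((+ 2 * a - + 2 * a) * (+ 2 * a - n + ε - + 2) + (ε - ε))
      ≡⟨ vanish (a * n) (+ 2 * a) (+ 2 * a - n + ε - + 2) ε ⟩
    0ℤ ∎))
    where
    open ≡-Reasoning
    identity : ∀ n a ε →
      (+ 5 * n * n - + 6 * n + ε) * (a * n) - (a * (a - 1ℤ) * n + (n * (n - 1ℤ) - a * (a - 1ℤ)) * a) * (+ 4 * n)
      ≡ a * n * ((+ 2 * a - (n + ε)) * (+ 2 * a - n + ε - + 2) + (ε * ε - ε))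
    identity = solve-∀
    vanish : ∀ k x y ε → k * ((x - x) * y + (ε - ε)) ≡ 0ℤ
    vanish = solve-∀

  extremal-numerator : ∀ {n a x} → 2 ℕ.* a ≡ n ℕ.+ n % 2 → a C 2 ℕ.+ x ≡ n C 2 →
    (+ (2 ℕ.* (a C 2)) * + n + + (2 ℕ.* x) * + a) * + (4 ℕ.* n) ≡ numer n * + (a ℕ.* n)
  extremal-numerator {n} {a} {x} 2a≡n+ε aC2+x≡nC2 = begin
    (+ (2 ℕ.* (a C 2)) * + n + + (2 ℕ.* x) * + a) * + (4 ℕ.* n)
      ≡⟨ cong₂ (λ p q → (p * + n + q * + a) * + (4 ℕ.* n)) twice-aC2 twice-x ⟩
    (+ a * (+ a - 1ℤ) * + n + (+ n * (+ n - 1ℤ) - + a * (+ a - 1ℤ)) * + a) * + (4 ℕ.* n)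
      ≡⟨ cong (_*_ (+ a * (+ a - 1ℤ) * + n + (+ n * (+ n - 1ℤ) - + a * (+ a - 1ℤ)) * + a)) (ℤₚ.pos-* 4 n) ⟩
    (+ a * (+ a - 1ℤ) * + n + (+ n * (+ n - 1ℤ) - + a * (+ a - 1ℤ)) * + a) * (+ 4 * + n)
      ≡⟨ extremal-cross-multiplied {+ n} {+ a} n+ε≡2a ε*ε≡ε ⟩
    numer n * (+ a * + n)
      ≡⟨ cong (_*_ (numer n)) (ℤₚ.pos-* a n) ⟨
    numer n * + (a ℕ.* n) ∎
    where
    open ≡-Reasoning
    twice-aC2 : + (2 ℕ.* (a C 2)) ≡ + a * (+ a - 1ℤ)
    twice-aC2 = trans (ℤₚ.pos-* 2 (a C 2)) (+2*nC2≡n*[n-1] a)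
    twice-x : + (2 ℕ.* x) ≡ + n * (+ n - 1ℤ) - + a * (+ a - 1ℤ)
    twice-x = begin
      + (2 ℕ.* x)                                  ≡⟨ ℤₚ.pos-* 2 x ⟩
      + 2 * + x                                    ≡⟨ identity (+ (a C 2)) (+ x) ⟩
      + 2 * (+ (a C 2) + + x) - + 2 * + (a C 2)    ≡⟨ cong (λ k → + 2 * k - + 2 * + (a C 2))
                                                        (trans (sym (ℤₚ.pos-+ (a C 2) x)) (cong +_ aC2+x≡nC2)) ⟩
      + 2 * + (n C 2) - + 2 * + (a C 2)            ≡⟨ cong₂ _-_ (+2*nC2≡n*[n-1] n) (+2*nC2≡n*[n-1] a) ⟩
      + n * (+ n - 1ℤ) - + a * (+ a - 1ℤ)          ∎
      where
      identity : ∀ p x → + 2 * x ≡ + 2 * (p + x) - + 2 * p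
      identity = solve-∀
    n+ε≡2a : + n + + (n % 2) ≡ + 2 * + a
    n+ε≡2a = trans (sym (ℤₚ.pos-+ n (n % 2))) (trans (cong +_ (sym 2a≡n+ε)) (ℤₚ.pos-* 2 a))
    ε*ε≡ε : + (n % 2) * + (n % 2) ≡ + (n % 2)
    ε*ε≡ε with n % 2 | n%2≡0⊎n%2≡1 n
    ... | _ | inj₁ refl = refl
    ... | _ | inj₂ refl = refl

open IntegerBounds using (numer; numerator-bound; extremal-numerator)

module Fractions where
  open import Data.Integer using (+_; -[1+_]; 0ℤ)
  import Data.Integer.Properties as ℤₚ
  open import Data.Integer.Tactic.RingSolver using (solve-∀)
  open import Data.Rational using (_+_; _-_; _≤_)

  /+/≡/ : ∀ p q k l → p / suc k + q / suc l ≡ (p ℤ.* + suc l ℤ.+ q ℤ.* + suc k) / (suc k ℕ.* suc l)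
  /+/≡/ p q k l = begin
    p / suc k + q / suc l                  ≡⟨ ℚₚ.fromℚᵘ-toℚᵘ _ ⟨
    fromℚᵘ (toℚᵘ (p / suc k + q / suc l))  ≡⟨ ℚₚ.fromℚᵘ-cong (ℚᵘₚ.≃-trans (ℚₚ.toℚᵘ-homo-+ (p / suc k) (q / suc l)) p+q≃) ⟩
    fromℚᵘ (mkℚᵘ p k ℚᵘ.+ mkℚᵘ q l)        ∎
    where
    open ≡-Reasoning
    p+q≃ : toℚᵘ (p / suc k) ℚᵘ.+ toℚᵘ (q / suc l) ℚᵘ.≃ mkℚᵘ p k ℚᵘ.+ mkℚᵘ q l
    p+q≃ = ℚᵘₚ.+-cong (ℚₚ.toℚᵘ-fromℚᵘ (mkℚᵘ p k)) (ℚₚ.toℚᵘ-fromℚᵘ (mkℚᵘ q l))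

  *≤*⇒/≤/ : ∀ {p q k l} → p ℤ.* + suc l ℤ.≤ q ℤ.* + suc k → p / suc k ≤ q / suc l
  *≤*⇒/≤/ {p} {q} {k} {l} h = ℚₚ.toℚᵘ-cancel-≤
    (ℚᵘₚ.≤-respˡ-≃ (ℚᵘₚ.≃-sym (ℚₚ.toℚᵘ-fromℚᵘ (mkℚᵘ p k)))
      (ℚᵘₚ.≤-respʳ-≃ (ℚᵘₚ.≃-sym (ℚₚ.toℚᵘ-fromℚᵘ (mkℚᵘ q l))) (*≤* h)))

  *≡*⇒/≡/ : ∀ {p q k l} → p ℤ.* + suc l ≡ q ℤ.* + suc k → p / suc k ≡ q / suc l
  *≡*⇒/≡/ {p} {q} {k} {l} h = ℚₚ.fromℚᵘ-cong {mkℚᵘ p k} {mkℚᵘ q l} (*≡* h)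

  fraction-sum-≤ : ∀ {p q r a b k l m} → a ≡ suc k → b ≡ suc l →
    (p ℤ.* + b ℤ.+ q ℤ.* + a) ℤ.* + suc m ℤ.≤ r ℤ.* + (a ℕ.* b) → p / suc k + q / suc l ≤ r / suc m
  fraction-sum-≤ {p} {q} {r} {k = k} {l} {m} refl refl h =
    ℚₚ.≤-trans (ℚₚ.≤-reflexive (/+/≡/ p q k l))
      (*≤*⇒/≤/ {p ℤ.* + suc l ℤ.+ q ℤ.* + suc k} {r} {l ℕ.+ k ℕ.* suc l} {m} h)

  fraction-sum-≡ : ∀ {p q r a b k l m} → a ≡ suc k → b ≡ suc l →
    (p ℤ.* + b ℤ.+ q ℤ.* + a) ℤ.* + suc m ≡ r ℤ.* + (a ℕ.* b) → p / suc k + q / suc l ≡ r / suc m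
  fraction-sum-≡ {p} {q} {r} {k = k} {l} {m} refl refl h =
    trans (/+/≡/ p q k l) (*≡*⇒/≡/ {p ℤ.* + suc l ℤ.+ q ℤ.* + suc k} {r} {l ℕ.+ k ℕ.* suc l} {m} h)

  pos-5n²-6n : ∀ n → + (5 ℕ.* n ℕ.* n) ℤ.- + (6 ℕ.* n) ≡ + 5 ℤ.* + n ℤ.* + n ℤ.- + 6 ℤ.* + n
  pos-5n²-6n n = cong₂ ℤ._-_ (trans (ℤₚ.pos-* (5 ℕ.* n) n) (cong (ℤ._* + n) (ℤₚ.pos-* 5 n))) (ℤₚ.pos-* 6 n)

  bound≡numer/4n : ∀ m → bound (suc m) ≡ numer (suc m) / (4 ℕ.* suc m)
  bound≡numer/4n m with suc m % 2 | n%2≡0⊎n%2≡1 (suc m)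
  ... | _ | inj₁ refl = cong (_/ (4 ℕ.* suc m)) (trans (sym (ℤₚ.+-identityʳ (+ (5 ℕ.* suc m ℕ.* suc m) ℤ.- + (6 ℕ.* suc m))))
                                                    (cong (ℤ._+ 0ℤ) (pos-5n²-6n (suc m))))
  ... | _ | inj₂ refl = cong (_/ (4 ℕ.* suc m)) (cong (ℤ._+ + 1) (pos-5n²-6n (suc m)))

  eps≡ε/4n : ∀ m → eps (suc m) ≡ + (suc m % 2) / (4 ℕ.* suc m)
  eps≡ε/4n m with suc m % 2 | n%2≡0⊎n%2≡1 (suc m)
  ... | _ | inj₁ refl = sym (ℚₚ.0/n≡0 (4 ℕ.* suc m))
  ... | _ | inj₂ refl = refl

  bound-closed-form : ∀ m → bound (suc m) ≡ (+ (5 ℕ.* suc m)) / 4 - (+ 3) / 2 + eps (suc m)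
  bound-closed-form m = begin
    bound n                                          ≡⟨ bound≡numer/4n m ⟩
    numer n / (4 ℕ.* n)                              ≡⟨ *≡*⇒/≡/ {numer n} {X} {m ℕ.+ 3 ℕ.* n} {l ℕ.+ 7 ℕ.* suc l} cross ⟩
    X / (8 ℕ.* (4 ℕ.* n))                            ≡⟨ /+/≡/ Y (+ ε) 7 l ⟨
    Y / 8 + (+ ε) / (4 ℕ.* n)                        ≡⟨ cong (_+ (+ ε) / (4 ℕ.* n)) (/+/≡/ (+ (5 ℕ.* n)) -[1+ 2 ] 3 1) ⟨
    (+ (5 ℕ.* n)) / 4 - (+ 3) / 2 + (+ ε) / (4 ℕ.* n) ≡⟨ cong (_+_ ((+ (5 ℕ.* n)) / 4 - (+ 3) / 2)) (eps≡ε/4n m) ⟨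
    (+ (5 ℕ.* n)) / 4 - (+ 3) / 2 + eps n            ∎
    where
    open ≡-Reasoning
    n l ε : ℕ
    n = suc m
    l = m ℕ.+ 3 ℕ.* n
    ε = n % 2
    -- Y / 8 is (+ (5 n)) / 4 − (+ 3) / 2, as − ((+ 3) / 2) unfolds to -[1+ 2 ] / 2.
    Y X : ℤ
    Y = + (5 ℕ.* n) ℤ.* + 2 ℤ.+ -[1+ 2 ] ℤ.* + 4
    X = Y ℤ.* + (4 ℕ.* n) ℤ.+ + ε ℤ.* + 8
    identity : ∀ N ε → (+ 5 ℤ.* N ℤ.* N ℤ.- + 6 ℤ.* N ℤ.+ ε) ℤ.* (+ 8 ℤ.* (+ 4 ℤ.* N))
                       ≡ ((+ 5 ℤ.* N ℤ.* + 2 ℤ.+ -[1+ 2 ] ℤ.* + 4) ℤ.* (+ 4 ℤ.* N) ℤ.+ ε ℤ.* + 8) ℤ.* (+ 4 ℤ.* N)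
    identity = solve-∀
    cross : numer n ℤ.* + (8 ℕ.* (4 ℕ.* n)) ≡ X ℤ.* + (4 ℕ.* n)
    cross = begin
      numer n ℤ.* + (8 ℕ.* (4 ℕ.* n))
        ≡⟨ cong (ℤ._*_ (numer n)) (trans (ℤₚ.pos-* 8 (4 ℕ.* n)) (cong (ℤ._*_ (+ 8)) (ℤₚ.pos-* 4 n))) ⟩
      numer n ℤ.* (+ 8 ℤ.* (+ 4 ℤ.* + n))
        ≡⟨ identity (+ n) (+ ε) ⟩
      ((+ 5 ℤ.* + n ℤ.* + 2 ℤ.+ -[1+ 2 ] ℤ.* + 4) ℤ.* (+ 4 ℤ.* + n) ℤ.+ + ε ℤ.* + 8) ℤ.* (+ 4 ℤ.* + n)
        ≡⟨ cong₂ (λ u v → ((u ℤ.* + 2 ℤ.+ -[1+ 2 ] ℤ.* + 4) ℤ.* v ℤ.+ + ε ℤ.* + 8) ℤ.* v)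
                 (ℤₚ.pos-* 5 n) (ℤₚ.pos-* 4 n) ⟨
      X ℤ.* + (4 ℕ.* n) ∎

open Fractions using (fraction-sum-≤; fraction-sum-≡; bound≡numer/4n; bound-closed-form)

module AverageDegree where
  open import Data.Integer using (+_)
  open import Data.Rational using (_≤_)

  density-cong : ∀ {n} {G H : Graph n} (S : Subset n) → edgesIn G S ≡ edgesIn H S → density G S ≡ density H S
  density-cong S eq with size S
  ... | zero  = refl
  ... | suc k = cong (λ e → (+ (2 ℕ.* e)) / suc k) eq

  density-∅ : ∀ {n} (G : Graph n) (S : Subset n) → ∣ S ∣ ≡ 0 → density G S ≡ 0ℚ
  density-∅ G S ∣S∣≡0 with size S | size≡∣∣ S
  ... | _ | refl rewrite ∣S∣≡0 = refl

  density≡2e/k : ∀ {n} (G : Graph n) (S : Subset n) {k} → ∣ S ∣ ≡ suc k →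
    density G S ≡ (+ (2 ℕ.* edgesIn G S)) / suc k
  density≡2e/k G S ∣S∣≡ with size S | size≡∣∣ S
  ... | _ | refl rewrite ∣S∣≡ = refl

  0≤density : ∀ {n} (G : Graph n) (S : Subset n) → 0ℚ ≤ density G S
  0≤density G S with size S
  ... | zero  = ℚₚ.≤-refl
  ... | suc k = ℚₚ.nonNegative⁻¹ _ {{ℚₚ.normalize-nonNeg (2 ℕ.* edgesIn G S) (suc k)}}

  foldr-⊔-upper : ∀ {X : Set} (f : X → ℚ) {x xs} → x ∈ xs → f x ≤ foldr (λ y m → f y ⊔ m) 0ℚ xs
  foldr-⊔-upper f (here refl)                = ℚₚ.p≤p⊔q _ _
  foldr-⊔-upper f {xs = y ∷ _} (there x∈xs) = ℚₚ.p≤q⇒p≤r⊔q (f y) (foldr-⊔-upper f x∈xs)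

  foldr-⊔-attained : ∀ {X : Set} (f : X → ℚ) xs →
    foldr (λ y m → f y ⊔ m) 0ℚ xs ≡ 0ℚ ⊎ ∃ λ x → foldr (λ y m → f y ⊔ m) 0ℚ xs ≡ f x
  foldr-⊔-attained f []       = inj₁ refl
  foldr-⊔-attained f (x ∷ xs) with ℚₚ.⊔-sel (f x) (foldr (λ y m → f y ⊔ m) 0ℚ xs)
  ... | inj₁ max≡fx = inj₂ (x , max≡fx)
  ... | inj₂ max≡rest with foldr-⊔-attained f xs
  ...   | inj₁ rest≡0        = inj₁ (trans max≡rest rest≡0)
  ...   | inj₂ (y , rest≡fy) = inj₂ (y , trans max≡rest rest≡fy)

  ∈-allSubsets : ∀ {n} (S : Subset n) → S ∈ allSubsets n
  ∈-allSubsets []                = here refl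
  ∈-allSubsets {suc n} (true ∷ S)  = ∈-++⁺ˡ (∈-map⁺ (true ∷_) (∈-allSubsets S))
  ∈-allSubsets {suc n} (false ∷ S) = ∈-++⁺ʳ (map (true ∷_) (allSubsets n)) (∈-map⁺ (false ∷_) (∈-allSubsets S))

  density≤Mad : ∀ {n} (G : Graph n) (S : Subset n) → density G S ≤ Mad G
  density≤Mad G S = foldr-⊔-upper (density G) (∈-allSubsets S)

  Mad≡0⇒Mad≡density⊤ : ∀ {n} (G : Graph n) → Mad G ≡ 0ℚ → Mad G ≡ density G ⊤
  Mad≡0⇒Mad≡density⊤ G Mad≡0 =
    ℚₚ.≤-antisym (subst (_≤ density G ⊤) (sym Mad≡0) (0≤density G ⊤)) (density≤Mad G ⊤)

  Mad-attained : ∀ {m} (G : Graph (suc m)) → ∃₂ λ S k → ∣ S ∣ ≡ suc k × Mad G ≡ density G S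
  Mad-attained {m} G with foldr-⊔-attained (density G) (allSubsets (suc m))
  ... | inj₁ Mad≡0 = ⊤ , m , ∣⊤∣≡n (suc m) , Mad≡0⇒Mad≡density⊤ G Mad≡0
  ... | inj₂ (S , Mad≡) with ∣ S ∣ in ∣S∣≡
  ...   | suc k = S , k , ∣S∣≡ , Mad≡
  ...   | zero  = ⊤ , m , ∣⊤∣≡n (suc m) , Mad≡0⇒Mad≡density⊤ G (trans Mad≡ (density-∅ G S ∣S∣≡))

open AverageDegree using (density-cong; density≡2e/k; density≤Mad; Mad-attained)

open import Data.Nat using (_≥_)
open import Data.Integer using (+_)
open import Data.Rational using (_≤_; _+_; _-_)

density-sum≤bound-ordered : ∀ {m} (G : Graph (suc m)) (A B : Subset (suc m)) → ∣ A ∣ ℕ.≤ ∣ B ∣ →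
  ∀ {a b} → ∣ A ∣ ≡ suc a → ∣ B ∣ ≡ suc b → density G A + density (complement G) B ≤ bound (suc m)
density-sum≤bound-ordered {m} G A B ∣A∣≤∣B∣ {a} {b} ∣A∣≡ ∣B∣≡ = begin
  density G A + density (complement G) B
    ≡⟨ cong₂ _+_ (density≡2e/k G A ∣A∣≡) (density≡2e/k (complement G) B ∣B∣≡) ⟩
  (+ (2 ℕ.* edgesIn G A)) / suc a + (+ (2 ℕ.* edgesIn (complement G) B)) / suc b
    ≤⟨ fraction-sum-≤ {+ (2 ℕ.* edgesIn G A)} {+ (2 ℕ.* edgesIn (complement G) B)} {numer (suc m)}
         ∣A∣≡ ∣B∣≡
         (numerator-bound {e = edgesIn G A} {f = edgesIn (complement G) B}
           (∣p∣≤n B) (∣A∣+∣B∣≤n+∣A∩B∣ A B) (double-count G A B ∣A∣≤∣B∣)) ⟩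
  numer (suc m) / (4 ℕ.* suc m)
    ≡⟨ bound≡numer/4n m ⟨
  bound (suc m) ∎
  where open ℚₚ.≤-Reasoning

density-sum≤bound : ∀ {m} (G : Graph (suc m)) (A B : Subset (suc m)) {a b} → ∣ A ∣ ≡ suc a → ∣ B ∣ ≡ suc b →
  density G A + density (complement G) B ≤ bound (suc m)
density-sum≤bound {m} G A B ∣A∣≡ ∣B∣≡ with ℕₚ.≤-total ∣ A ∣ ∣ B ∣
... | inj₁ ∣A∣≤∣B∣ = density-sum≤bound-ordered G A B ∣A∣≤∣B∣ ∣A∣≡ ∣B∣≡
... | inj₂ ∣B∣≤∣A∣ = begin
  density G A + density Ḡ B
    ≡⟨ ℚₚ.+-comm (density G A) (density Ḡ B) ⟩
  density Ḡ B + density G A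
    ≡⟨ cong (_+_ (density Ḡ B)) (density-cong A (edgesIn-complement-involutive G A)) ⟨
  density Ḡ B + density (complement Ḡ) A
    ≤⟨ density-sum≤bound-ordered Ḡ B A ∣B∣≤∣A∣ ∣B∣≡ ∣A∣≡ ⟩
  bound (suc m) ∎
  where
  open ℚₚ.≤-Reasoning
  Ḡ : Graph (suc m)
  Ḡ = complement G

Mad-sum≤bound : ∀ {m} (G : Graph (suc m)) → Mad G + Mad (complement G) ≤ bound (suc m)
Mad-sum≤bound G with Mad-attained G | Mad-attained (complement G)
... | A , _ , ∣A∣≡ , Mad≡ | B , _ , ∣B∣≡ , Mad̄≡ =
  subst₂ (λ x y → x + y ≤ _) (sym Mad≡) (sym Mad̄≡) (density-sum≤bound G A B ∣A∣≡ ∣B∣≡)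

clique-density-sum : ∀ m {A : Subset (suc m)} → ∣ A ∣ ≡ ⌈ suc m /2⌉ →
  density (clique A) A + density (complement (clique A)) ⊤ ≡ bound (suc m)
clique-density-sum m {A} ∣A∣≡a = begin
  density G A + density Ḡ ⊤
    ≡⟨ cong₂ _+_ (trans (density≡2e/k G A ∣A∣≡a) (cong (λ e → (+ (2 ℕ.* e)) / a) edges-A))
                 (density≡2e/k Ḡ ⊤ (∣⊤∣≡n n)) ⟩
  (+ (2 ℕ.* (a C 2))) / a + (+ (2 ℕ.* edgesIn Ḡ ⊤)) / n
    ≡⟨ fraction-sum-≡ {+ (2 ℕ.* (a C 2))} {+ (2 ℕ.* edgesIn Ḡ ⊤)} {numer n} {a} {n} refl refl
         (extremal-numerator {n} {a} (2⌈n/2⌉≡n+n%2 n) complement-edges) ⟩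
  numer n / (4 ℕ.* n)
    ≡⟨ bound≡numer/4n m ⟨
  bound n ∎
  where
  open ≡-Reasoning
  n a : ℕ
  n = suc m
  a = ⌈ n /2⌉
  G Ḡ : Graph n
  G = clique A
  Ḡ = complement G
  clique-edges : ∀ {S} → A ⊆ S → edgesIn G S ≡ a C 2
  clique-edges A⊆S = trans (edgesIn-clique A⊆S) (trans (pairsIn≡∣∣C2 A) (cong (_C 2) ∣A∣≡a))
  edges-A : edgesIn G A ≡ a C 2
  edges-A = clique-edges ⊆-refl
  complement-edges : a C 2 ℕ.+ edgesIn Ḡ ⊤ ≡ n C 2
  complement-edges = trans (cong (ℕ._+ edgesIn Ḡ ⊤) (sym (clique-edges ⊆⊤)))
    (trans (edgesIn+edgesIn-complement G ⊤) (trans (pairsIn≡∣∣C2 (⊤ {n})) (cong (_C 2) (∣⊤∣≡n n))))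

extremal-graph : ∀ m → ∃ λ (G : Graph (suc m)) → Mad G + Mad (complement G) ≡ bound (suc m)
extremal-graph m with subset-of-size (ℕₚ.⌈n/2⌉≤n (suc m))
... | A , ∣A∣≡a = clique A , ℚₚ.≤-antisym (Mad-sum≤bound (clique A)) (begin
  bound (suc m)
    ≡⟨ clique-density-sum m {A} ∣A∣≡a ⟨
  density (clique A) A + density (complement (clique A)) ⊤
    ≤⟨ ℚₚ.+-mono-≤ (density≤Mad (clique A) A) (density≤Mad (complement (clique A)) ⊤) ⟩
  Mad (clique A) + Mad (complement (clique A)) ∎)
  where open ℚₚ.≤-Reasoning

-- n ≥ 3 only rules out n = 0: the three claims hold for every n ≥ 1.
theorem4p1 : (n : ℕ) → (n≥3 : n ≥ 3)
    → ((G : Graph n) → Mad G + Mad (complement G) ≤ bound n)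
    × (∃ λ (G : Graph n) → Mad G + Mad (complement G) ≡ bound n)
    × (bound n ≡ ((+ (5 Data.Nat.* n)) / 4 - (+ 3) / 2) + eps n)
theorem4p1 zero    ()
theorem4p1 (suc m) _ = Mad-sum≤bound , extremal-graph m , bound-closed-form m
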